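{- If $P$ is a dcpo with a countable weak basis, then $|P|\le\mathfrak c$, where $\mathfrak c$ is the cardinality of the continuum.
   Context: A dcpo is a partial order $(P,\preceq)$ in which every directed subset $A$ (nonempty, any two elements have an upper bound in $A$) has a supremum $\sqcup A$. A weak basis of $P$ is a subset $B\subseteq P$ such that each $x\in P$ equals $\sqcup B_x$ for some directed set $B_x\subseteq B$. -}

module Defs where

open import Level using (Level; _⊔_; suc)
open import Data.Nat using (ℕ)
open import Data.Product using (Σ; ∃; _×_; _,_; proj₁)
open import Relation.Binary.Bundles using (Poset)
open import Relation.Binary.PropositionalEquality using (_≡_)
open import Relation.Unary using (Pred; _∈_; _⊆_)

module _ {c ℓ₁ ℓ₂ : Level} (P : Poset c ℓ₁ ℓ₂) where
  open Poset P renaming (Carrier to X; _≤_ to _⪯_)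

  Directed : {ℓ : Level} → Pred X ℓ → Set (c ⊔ ℓ₂ ⊔ ℓ)
  Directed A = (∃ λ x → x ∈ A)
             × (∀ x y → x ∈ A → y ∈ A → ∃ λ z → z ∈ A × x ⪯ z × y ⪯ z)

  IsSup : {ℓ : Level} → Pred X ℓ → X → Set (c ⊔ ℓ₂ ⊔ ℓ)
  IsSup A s = (∀ a → a ∈ A → a ⪯ s)
            × (∀ u → (∀ a → a ∈ A → a ⪯ u) → s ⪯ u)

  IsDcpo : (ℓ : Level) → Set (c ⊔ ℓ₂ ⊔ suc ℓ)
  IsDcpo ℓ = (A : Pred X ℓ) → Directed A → ∃ λ s → IsSup A s

  IsWeakBasis : {ℓ : Level} → Pred X ℓ → Set (c ⊔ ℓ₂ ⊔ suc ℓ)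
  IsWeakBasis {ℓ} B = ∀ x → Σ (Pred X ℓ) λ Bx → Bx ⊆ B × Directed Bx × IsSup Bx x

  Countable : {ℓ : Level} → Pred X ℓ → Set (c ⊔ ℓ₁ ⊔ ℓ)
  Countable B = Σ (Σ X B → ℕ) λ f → ∀ b b' → f b ≡ f b' → proj₁ b ≈ proj₁ b'

{-# OPTIONS --safe #-}
module Submission where

-- Code x ∈ P by the set of indices of basis elements below x.  Since x is the
-- supremum of basis elements, x ⪯ y as soon as every basis element below x is
-- below y; so this set determines x up to ≈, and with excluded middle its
-- characteristic function is an injection of P into ℕ → Bool.

open import Defs
open import Level using (Level; _⊔_; Lift; lift)
open import Data.Nat using (ℕ)
open import Data.Bool using (Bool; T)
open import Data.Product using (Σ; ∃; _×_; _,_; proj₁)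
open import Function using (_$_)
open import Relation.Binary.Bundles using (Poset)
open import Relation.Binary.PropositionalEquality using (_≡_; refl; sym; cong; subst)
open import Relation.Unary using (Pred; _∈_)
open import Relation.Nullary.Decidable using (isYes; toWitness; fromWitness)
open import Axiom.ExcludedMiddle using (ExcludedMiddle)

module _ {a b} {A : Set b} (em : ExcludedMiddle a) where

  characteristic : Pred A a → A → Bool
  characteristic p n = isYes (em {p n})

  characteristic-≡⇒⊆ : ∀ {p q : Pred A a} →
    characteristic p ≡ characteristic q → ∀ n → p n → q n
  characteristic-≡⇒⊆ {p} {q} eq n pn =
    toWitness {a? = em {q n}} (subst T (cong (_$ n) eq) (fromWitness {a? = em {p n}} pn))

module _ {c ℓ₁ ℓ₂ ℓ} (P : Poset c ℓ₁ ℓ₂) {B : Pred (Poset.Carrier P) ℓ} where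
  open Poset P using (reflexive) renaming (Carrier to X; _≤_ to _⪯_; trans to ⪯-trans)

  weakBasis-≤ : IsWeakBasis P B →
    ∀ x y → (∀ b → b ∈ B → b ⪯ x → b ⪯ y) → x ⪯ y
  weakBasis-≤ wb x y below⇒below with wb x
  ... | _ , Bx⊆B , _ , x-ub , x-least =
    x-least y λ b b∈Bx → below⇒below b (Bx⊆B b∈Bx) (x-ub b b∈Bx)

  -- Lifted so that excluded middle at the level of the poset applies to it.
  BelowCode : (Σ X B → ℕ) → X → Pred ℕ (c ⊔ ℓ₁ ⊔ ℓ₂ ⊔ ℓ)
  BelowCode code x n = Lift ℓ₁ (∃ λ (b : Σ X B) → code b ≡ n × proj₁ b ⪯ x)

  belowCode⇒≤ : ((code , _) : Countable P B) →
    ∀ x b → BelowCode code x (code b) → proj₁ b ⪯ x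
  belowCode⇒≤ (_ , code-inj) x b (lift (b' , code-b'≡code-b , b'⪯x)) =
    ⪯-trans (reflexive (code-inj b b' (sym code-b'≡code-b))) b'⪯x

  belowCode-⊆⇒≤ : IsWeakBasis P B → ((code , _) : Countable P B) →
    ∀ x y → (∀ n → BelowCode code x n → BelowCode code y n) → x ⪯ y
  belowCode-⊆⇒≤ wb countable@(code , _) x y ⊆ = weakBasis-≤ wb x y λ b b∈B b⪯x →
    belowCode⇒≤ countable y (b , b∈B) (⊆ (code (b , b∈B)) (lift ((b , b∈B) , refl , b⪯x)))

proposition7 : {c ℓ₁ ℓ₂ ℓ : Level} → ExcludedMiddle (c ⊔ ℓ₁ ⊔ ℓ₂ ⊔ ℓ) →
    (P : Poset c ℓ₁ ℓ₂) → IsDcpo P ℓ →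
    (B : Pred (Poset.Carrier P) ℓ) → IsWeakBasis P B → Countable P B →
    Σ (Poset.Carrier P → (ℕ → Bool)) λ h →
      ∀ x y → h x ≡ h y → Poset._≈_ P x y
proposition7 em P _ B wb countable@(code , _) = h , h-injective
  where
  h : Poset.Carrier P → ℕ → Bool
  h x = characteristic em (BelowCode P code x)

  h-injective : ∀ x y → h x ≡ h y → Poset._≈_ P x y
  h-injective x y hx≡hy = Poset.antisym P
    (belowCode-⊆⇒≤ P wb countable x y (characteristic-≡⇒⊆ em hx≡hy))
    (belowCode-⊆⇒≤ P wb countable y x (characteristic-≡⇒⊆ em (sym hx≡hy)))
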